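{- Let $\mathcal L$ be one of $\textup{FO}(<)$, $\textup{FO}(<,\equiv)$, $\textup{FO}(\textup{RPR})$. Let $(\mathcal T,B)$ be a $\textsl{DL-Lite}^{\boldsymbol o}_{\boldsymbol c/\boldsymbol r}$ OMAQ whose ontology is a TBox $\mathcal T$ (no role inclusions) in which $\bot$ does not occur, and $B$ is a basic concept. If the $\textsl{LTL}^{\boldsymbol o}_{\boldsymbol c}$ OMAQ $(\mathcal T^\dagger,B^\dagger)$ is $\mathcal L$-rewritable, then $(\mathcal T,B)$ is $\mathcal L$-rewritable.
   Context: Temporal DL-Lite. Roles $S ::= P\mid P^-$ ($P$ a role name); basic concepts $B ::= A\mid\exists S$ ($A$ a concept name); temporalised concepts $C ::= B\mid\Box_F C\mid\Box_P C\mid\bigcirc_F C\mid\bigcirc_P C$. A CI is $C_1\sqcap\dots\sqcap C_k\sqsubseteq C_{k+1}\sqcup\dots\sqcup C_{k+m}$ (empty $\sqcap=\top$, empty $\sqcup=\bot$); a TBox is a finite set of CIs. $\boldsymbol o\in\{\Box,\bigcirc,\Box\bigcirc\}$ indicates allowed operators ($\Box$: $\Box_F,\Box_P$; $\bigcirc$: $\bigcirc_F,\bigcirc_P$; $\Box\bigcirc$: all four); $\boldsymbol c$ restricts CIs ($\textit{horn}$: $m\le1$; $\textit{krom}$: $k+m\le2$; $\textit{core}$: $k+m\le2$, $m\le1$; $\textit{g-bool}$: $k\ge1$; $\textit{bool}$: none), $\boldsymbol r$ likewise restricts role inclusions. ABoxes: finite sets of $A(a,\ell)$, $P(a,b,\ell)$,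 $\ell\in\mathbb Z$; $\mathsf{ind}(\mathcal A)$ its individuals; $\mathsf{tem}(\mathcal A)=\{n\mid\min\mathcal A\le n\le\max\mathcal A\}$. Temporal interpretations have a nonempty domain, time-independent individuals (no unique name assumption) and, for each $n\in\mathbb Z$, extensions of names; $(\exists S)^{\mathcal I(n)}$ is the domain of $S^{\mathcal I(n)}$ ($(P^-)^{\mathcal I(n)}$ the converse of $P^{\mathcal I(n)}$), $(\Box_F C)^{\mathcal I(n)}=\bigcap_{k>n}C^{\mathcal I(k)}$, $(\Box_P C)^{\mathcal I(n)}=\bigcap_{k<n}C^{\mathcal I(k)}$, $(\bigcirc_F C)^{\mathcal I(n)}=C^{\mathcal I(n+1)}$, $(\bigcirc_P C)^{\mathcal I(n)}=C^{\mathcal I(n-1)}$. Inclusions hold globally (at all $n$); models satisfy ontology and ABox. For an OMAQ $(\mathcal T,B)$, $\mathsf{ans}((\mathcal T,B),\mathcal A)$ is the set of $(a,\ell)\in\mathsf{ind}(\mathcal A)\times\mathsf{tem}(\mathcal A)$ with $a^{\mathcal I}\in B^{\mathcal I(\ell)}$ in every model $\mathcal I$ of $(\mathcal T,\mathcal A)$. Rewritings. An ABox $\mathcal A$ with $\mathsf{ind}(\mathcal A)=\{a_0,\dots,a_m\}$ is normalised (by adding dummy assertions with a fresh concept name) so that $\min\mathcal A=0$ and $\max\mathcal A\ge\max(1,m)$; $a_k$ is identified with $k$, and $\mathcal A$ is represented by the structure $\mathfrak S_{\mathcal A}$ with domain $\mathsf{tem}(\mathcal A)$, order $<$, $\mathfrak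 S_{\mathcal A}\models A(k,\ell)$ iff $A(a_k,\ell)\in\mathcal A$, $\mathfrak S_{\mathcal A}\models P(k,k',\ell)$ iff $P(a_k,a_{k'},\ell)\in\mathcal A$. $\textup{FO}(<)$-formulas use such data atoms, equality and $<$; $\textup{FO}(<,\equiv)$ additionally allows atoms $t\equiv0\pmod n$ for fixed $n>1$; $\textup{FO}(\textup{RPR})$ extends $\textup{FO}(<)$ with relational primitive recursion, i.e. formulas $[Q_i(\vec z_i,t)\equiv\Theta_i(\vec z_i,t,Q_1(\vec z_1,t-1),\dots,Q_n(\vec z_n,t-1))]_{1\le i\le n}\,\Psi$ defining predicates $Q_i$ by recursion on $t$ starting from $0$ with $Q_i(\cdot,-1)$ false. A constant-free $\mathcal L$-formula $\boldsymbol Q(x,t)$ is an $\mathcal L$-rewriting of $(\mathcal T,B)$ if $\mathsf{ans}((\mathcal T,B),\mathcal A)=\{(a,\ell)\in\mathsf{ind}(\mathcal A)\times\mathsf{tem}(\mathcal A)\mid\mathfrak S_{\mathcal A}\models\boldsymbol Q(a,\ell)\}$ for every ABox $\mathcal A$. LTL. An $\textsl{LTL}^{\boldsymbol o}_{\boldsymbol c}$ OMAQ is $(\mathcal O,A)$ with $\mathcal O$ a role-free TBox (concept names only, allowed operators $\boldsymbol o$, restriction $\boldsymbol c$) and $A$ a concept name; it is interpreted over one-element temporal interpretations. LTL ABoxes are finite sets of atoms $A(\ell)$; the certain answers are the $\ell\in\mathsf{tem}(\mathcal A)$ with $A$ true at $\ell$ in every model. An $\mathcal L$-rewriting of an LTL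 OMAQ is a constant-free $\mathcal L$-formula $\boldsymbol Q(t)$ over the structure with domain $\mathsf{tem}(\mathcal A)$ and unary predicates $A(\ell)$ (true iff $A(\ell)\in\mathcal A$) defining exactly the certain answers, for every LTL ABox. $\mathcal T^\dagger$ is obtained from $\mathcal T$ by replacing every basic concept $\exists S$ with a fresh concept name $E_S$ (the surrogate of $\exists S$), leaving concept names unchanged; $B^\dagger=B$ if $B$ is a concept name and $(\exists S)^\dagger=E_S$. -}

module Defs where

open import Level using (Level; _⊔_) renaming (suc to lsuc; zero to lzero)
open import Data.Nat as ℕ using (ℕ; zero; suc; _≤_; _<_; _≡ᵇ_)
  renaming (_⊔_ to _⊔ℕ_)
open import Data.Nat.Divisibility using (_∣_)
open import Data.Integer as ℤ using (ℤ; +_) renaming (_<_ to _<ℤ_)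
open import Data.Bool using (Bool; true; false; if_then_else_)
open import Data.List using (List; []; _∷_; foldr; map; concatMap)
open import Data.List.Relation.Unary.All using (All)
open import Data.List.Relation.Unary.Any using (Any)
open import Data.List.Membership.Propositional using (_∈_)
open import Data.Maybe using (Maybe; just; nothing)
open import Data.Product using (Σ; _×_; _,_)
open import Data.Sum using (_⊎_; inj₁; inj₂)
open import Data.Empty using (⊥)
open import Data.Unit using (⊤; tt)
open import Relation.Nullary using (¬_)
open import Relation.Binary.PropositionalEquality using (_≡_)
open import Function.Bundles using (_⇔_)

data Role (RN : Set) : Set where
  pos : RN → Role RN
  inv : RN → Role RN

data Basic (CN RN : Set) : Set where
  atom : CN → Basic CN RN
  ex   : Role RN → Basic CN RN

data TConcept (CN RN : Set) : Set where
  basic : Basic CN RN → TConcept CN RN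
  □F □P ○F ○P : TConcept CN RN → TConcept CN RN

-- C₁ ⊓ … ⊓ Cₖ ⊑ Cₖ₊₁ ⊔ … ⊔ Cₖ₊ₘ  (empty ⊓ = ⊤, empty ⊔ = ⊥)
record CI (CN RN : Set) : Set where
  constructor _⊑_
  field
    lhs : List (TConcept CN RN)
    rhs : List (TConcept CN RN)

TBox : Set → Set → Set
TBox CN RN = List (CI CN RN)

-- ⊥ does not occur in T: no CI has an empty right-hand side (m ≥ 1)
data NonEmpty {A : Set} : List A → Set where
  nonEmpty : ∀ x xs → NonEmpty (x ∷ xs)

NoBot : {CN RN : Set} → TBox CN RN → Set
NoBot T = All (λ α → NonEmpty (CI.rhs α)) T

record Interp (CN RN : Set) : Set₁ where
  field
    Δ    : Set
    ind  : ℕ → Δ                         -- individual aₖ (k ∈ ℕ); no UNA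
    conc : CN → ℤ → Δ → Set
    role : RN → ℤ → Δ → Δ → Set

module _ {CN RN : Set} (I : Interp CN RN) where
  open Interp I

  roleExt : Role RN → ℤ → Δ → Δ → Set
  roleExt (pos P) n d e = role P n d e
  roleExt (inv P) n d e = role P n e d

  basicExt : Basic CN RN → ℤ → Δ → Set
  basicExt (atom A) n d = conc A n d
  basicExt (ex S)   n d = Σ Δ λ e → roleExt S n d e

  conceptExt : TConcept CN RN → ℤ → Δ → Set
  conceptExt (basic B) n d = basicExt B n d
  conceptExt (□F C) n d = ∀ k → n <ℤ k → conceptExt C k d
  conceptExt (□P C) n d = ∀ k → k <ℤ n → conceptExt C k d
  conceptExt (○F C) n d = conceptExt C (n ℤ.+ ℤ.1ℤ) d
  conceptExt (○P C) n d = conceptExt C (n ℤ.- ℤ.1ℤ) d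

  SatCI : CI CN RN → Set
  SatCI (ls ⊑ rs) = ∀ n d → All (λ C → conceptExt C n d) ls →
                              Any (λ C → conceptExt C n d) rs

  ModelT : TBox CN RN → Set
  ModelT T = All SatCI T

-- DL ABoxes (already normalised: time stamps in ℕ, individual aₖ = k)

data Assertion (CN RN : Set) : Set where
  cAss : CN → ℕ → ℕ → Assertion CN RN          -- A(aₖ, ℓ)
  rAss : RN → ℕ → ℕ → ℕ → Assertion CN RN      -- P(aₖ, aₖ', ℓ)

ABox : Set → Set → Set
ABox CN RN = List (Assertion CN RN)

module _ {CN RN : Set} where
  indsOf : Assertion CN RN → List ℕ
  indsOf (cAss _ a _)   = a ∷ []
  indsOf (rAss _ a b _) = a ∷ b ∷ []

  timeOf : Assertion CN RN → ℕ
  timeOf (cAss _ _ ℓ)   = ℓ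
  timeOf (rAss _ _ _ ℓ) = ℓ

  _∈ind_ : ℕ → ABox CN RN → Set
  k ∈ind 𝒜 = k ∈ concatMap indsOf 𝒜

  tmax : ABox CN RN → ℕ
  tmax 𝒜 = foldr (λ α m → timeOf α ⊔ℕ m) 0 (𝒜)

  Normalised : ABox CN RN → Set
  Normalised 𝒜 = Σ ℕ λ m →
      (∀ k → (k ∈ind 𝒜) ⇔ (k ≤ m))
    × Any (λ α → timeOf α ≡ 0) 𝒜
    × (1 ⊔ℕ m ≤ tmax 𝒜)

  ModelA : ABox CN RN → Interp CN RN → Set
  ModelA 𝒜 I = All sat 𝒜
    where
      open Interp I
      sat : Assertion CN RN → Set
      sat (cAss A a ℓ)   = conc A (+ ℓ) (ind a)
      sat (rAss P a b ℓ) = role P (+ ℓ) (ind a) (ind b)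

  -- (a, ℓ) is a certain answer (without the membership in ind × tem)
  Certain : TBox CN RN → Basic CN RN → ABox CN RN → ℕ → ℕ → Set₁
  Certain T B 𝒜 a ℓ = (I : Interp CN RN) → ModelT I T → ModelA 𝒜 I →
                      basicExt I B (+ ℓ) (Interp.ind I a)

-- LTL: role-free TBoxes (no role names: RN = ⊥), one-element interpretations

LTLTBox : Set → Set
LTLTBox CN = TBox CN ⊥

oneElt : {CN : Set} → (CN → ℤ → Set) → Interp CN ⊥
oneElt v = record { Δ = ⊤ ; ind = λ _ → tt ; conc = λ A n _ → v A n ; role = λ () }

LTLABox : Set → Set
LTLABox CN = List (CN × ℕ)

module _ {CN : Set} where
  ltmax : LTLABox CN → ℕ
  ltmax 𝒜 = foldr (λ { (_ , ℓ) m → ℓ ⊔ℕ m }) 0 𝒜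

  LNormalised : LTLABox CN → Set
  LNormalised 𝒜 = Any (λ α → Data.Product.proj₂ α ≡ 0) 𝒜

  LCertain : LTLTBox CN → CN → LTLABox CN → ℕ → Set₁
  LCertain O A 𝒜 ℓ = (v : CN → ℤ → Set) → ModelT (oneElt v) O →
                     All (λ { (B , k) → v B (+ k) }) 𝒜 → v A (+ ℓ)

module _ {CN RN : Set} where
  † : Basic CN RN → Basic (CN ⊎ Role RN) ⊥
  † (atom A) = atom (inj₁ A)
  † (ex S)   = atom (inj₂ S)       -- the surrogate E_S

  †C : TConcept CN RN → TConcept (CN ⊎ Role RN) ⊥
  †C (basic B) = basic († B)
  †C (□F C) = □F (†C C)
  †C (□P C) = □P (†C C)
  †C (○F C) = ○F (†C C)
  †C (○P C) = ○P (†C C)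

  †T : TBox CN RN → LTLTBox (CN ⊎ Role RN)
  †T = map (λ { (ls ⊑ rs) → map †C ls ⊑ map †C rs })

Var : Set
Var = ℕ

mutual
  data Fm (Pr : Set) : Set where
    dat   : Pr → List Var → Fm Pr
    _≐_   : Var → Var → Fm Pr
    _≺_   : Var → Var → Fm Pr
    modZ  : ℕ → Var → Fm Pr
    rel   : ℕ → List Var → Fm Pr
    rpr   : List (RDef Pr) → Fm Pr → Fm Pr
    ¬'    : Fm Pr → Fm Pr
    _∧'_ _∨'_ : Fm Pr → Fm Pr → Fm Pr
    ∀' ∃' : Var → Fm Pr → Fm Pr

  -- def q zs t Θ :  Q_q(zs, t) ≡ Θ.  Inside Θ an atom  rel q' args  with q'
  -- one of the relations defined in the same block denotes Q_q'(args, t-1).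
  data RDef (Pr : Set) : Set where
    def : ℕ → List Var → Var → Fm Pr → RDef Pr

record Structure (Pr : Set) : Set₁ where
  field
    N : ℕ                          -- domain {0,…,N}
    D : Pr → List ℕ → Set

Env : Set
Env = Var → ℕ

RelEnv : Set₁
RelEnv = ℕ → List ℕ → Set

_[_↦_] : Env → Var → ℕ → Env
(σ [ v ↦ n ]) w = if w ≡ᵇ v then n else σ w

_[_↦*_] : Env → List Var → List ℕ → Env
σ [ v ∷ vs ↦* n ∷ ns ] = (σ [ v ↦ n ]) [ vs ↦* ns ]
σ [ _ ↦* _ ] = σ

names : {Pr : Set} → List (RDef Pr) → List ℕ
names [] = []
names (def q _ _ _ ∷ ds) = q ∷ names ds

memb : ℕ → List ℕ → Bool
memb q [] = false
memb q (x ∷ xs) = if q ≡ᵇ x then true else memb q xs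

override : {Pr : Set} → List (RDef Pr) → RelEnv → RelEnv → RelEnv
override ds new ρ q = if memb q (names ds) then new q else ρ q

splitLast : List ℕ → Maybe (List ℕ × ℕ)
splitLast [] = nothing
splitLast (x ∷ []) = just ([] , x)
splitLast (x ∷ xs@(_ ∷ _)) with splitLast xs
... | just (ys , y) = just (x ∷ ys , y)
... | nothing = nothing

module Semantics {Pr : Set} (𝔖 : Structure Pr) where
  open Structure 𝔖

  mutual
    sat : Env → RelEnv → Fm Pr → Set
    sat σ ρ (dat p vs)  = D p (map σ vs)
    sat σ ρ (x ≐ y)     = σ x ≡ σ y
    sat σ ρ (x ≺ y)     = σ x < σ y
    sat σ ρ (modZ n x)  = n ∣ σ x
    sat σ ρ (rel q vs)  = ρ q (map σ vs)
    sat σ ρ (rpr ds ψ)  = sat σ (override ds (full σ ρ ds) ρ) ψ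
    sat σ ρ (¬' φ)      = ¬ sat σ ρ φ
    sat σ ρ (φ ∧' ψ)    = sat σ ρ φ × sat σ ρ ψ
    sat σ ρ (φ ∨' ψ)    = sat σ ρ φ ⊎ sat σ ρ ψ
    sat σ ρ (∀' v φ)    = ∀ n → n ≤ N → sat (σ [ v ↦ n ]) ρ φ
    sat σ ρ (∃' v φ)    = Σ ℕ λ n → n ≤ N × sat (σ [ v ↦ n ]) ρ φ

    -- Q_q(zs, t) as a predicate on (zs ++ [t])
    full : Env → RelEnv → List (RDef Pr) → RelEnv
    full σ ρ ds q args with splitLast args
    ... | just (zs , t) = cur σ ρ ds t q zs
    ... | nothing = ⊥

    cur : Env → RelEnv → List (RDef Pr) → ℕ → RelEnv
    cur σ ρ ds t q zs = step σ ρ ds t (prev σ ρ ds t) ds q zs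

    -- Q_q(·, t-1), false for t = 0
    prev : Env → RelEnv → List (RDef Pr) → ℕ → RelEnv
    prev σ ρ ds zero    _ _ = ⊥
    prev σ ρ ds (suc t) q zs = cur σ ρ ds t q zs

    step : Env → RelEnv → List (RDef Pr) → ℕ → RelEnv →
           List (RDef Pr) → RelEnv
    step σ ρ ds t pv [] q zs = ⊥
    step σ ρ ds t pv (def q' vs tv θ ∷ es) q zs =
      if q ≡ᵇ q'
        then sat ((σ [ vs ↦* zs ]) [ tv ↦ t ]) (override ds pv ρ) θ
        else step σ ρ ds t pv es q zs

data Lang : Set where
  FO< FO<≡ FORPR : Lang

mutual
  Allowed : {Pr : Set} → Lang → Fm Pr → Set
  Allowed L (dat _ _) = ⊤
  Allowed L (_ ≐ _)   = ⊤
  Allowed L (_ ≺ _)   = ⊤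
  Allowed FO<≡  (modZ n _) = 1 < n
  Allowed FO<   (modZ _ _) = ⊥
  Allowed FORPR (modZ _ _) = ⊥
  Allowed FORPR (rel _ _)  = ⊤
  Allowed FO<   (rel _ _)  = ⊥
  Allowed FO<≡  (rel _ _)  = ⊥
  Allowed FORPR (rpr ds ψ) = AllowedDefs ds × Allowed FORPR ψ
  Allowed FO<   (rpr _ _)  = ⊥
  Allowed FO<≡  (rpr _ _)  = ⊥
  Allowed L (¬' φ)    = Allowed L φ
  Allowed L (φ ∧' ψ)  = Allowed L φ × Allowed L ψ
  Allowed L (φ ∨' ψ)  = Allowed L φ × Allowed L ψ
  Allowed L (∀' _ φ)  = Allowed L φ
  Allowed L (∃' _ φ)  = Allowed L φ

  AllowedDefs : {Pr : Set} → List (RDef Pr) → Set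
  AllowedDefs [] = ⊤
  AllowedDefs (def _ _ _ θ ∷ ds) = Allowed FORPR θ × AllowedDefs ds

-- Free variable conventions: x is variable 0, t is variable 1
-- (other variables default to 0; relation variables default to false).
initEnv : ℕ → ℕ → Env
initEnv a ℓ 0 = a
initEnv a ℓ 1 = ℓ
initEnv a ℓ _ = 0

initRel : RelEnv
initRel _ _ = ⊥

𝔖 : {CN RN : Set} → ABox CN RN → Structure (CN ⊎ RN)
𝔖 𝒜 = record { N = tmax 𝒜 ; D = D }
  where
    D : _ → List ℕ → Set
    D (inj₁ A) (k ∷ ℓ ∷ []) = cAss A k ℓ ∈ 𝒜
    D (inj₂ P) (k ∷ k' ∷ ℓ ∷ []) = rAss P k k' ℓ ∈ 𝒜
    D _ _ = ⊥

𝔖L : {CN : Set} → LTLABox CN → Structure CN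
𝔖L 𝒜 = record { N = ltmax 𝒜 ; D = D }
  where
    D : _ → List ℕ → Set
    D A (ℓ ∷ []) = (A , ℓ) ∈ 𝒜
    D _ _ = ⊥

IsRewriting : {CN RN : Set} → Lang → TBox CN RN → Basic CN RN →
              Fm (CN ⊎ RN) → Set₁
IsRewriting L T B Q =
  Allowed L Q ×
  (∀ (𝒜 : ABox _ _) → Normalised 𝒜 → ∀ a ℓ → a ∈ind 𝒜 → ℓ ≤ tmax 𝒜 →
     Certain T B 𝒜 a ℓ ⇔ Semantics.sat (𝔖 𝒜) (initEnv a ℓ) initRel Q)

Rewritable : {CN RN : Set} → Lang → TBox CN RN → Basic CN RN → Set₁
Rewritable L T B = Σ (Fm _) (IsRewriting L T B)

IsLRewriting : {CN : Set} → Lang → LTLTBox CN → CN → Fm CN → Set₁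
IsLRewriting L O A Q =
  Allowed L Q ×
  (∀ (𝒜 : LTLABox _) → LNormalised 𝒜 → ∀ ℓ → ℓ ≤ ltmax 𝒜 →
     LCertain O A 𝒜 ℓ ⇔ Semantics.sat (𝔖L 𝒜) (initEnv 0 ℓ) initRel Q)

LRewritable : {CN : Set} → Lang → LTLTBox CN → CN → Set₁
LRewritable L O A = Σ (Fm _) (IsLRewriting L O A)

†name : {CN RN : Set} → Basic CN RN → CN ⊎ Role RN
†name (atom A) = inj₁ A
†name (ex S)   = inj₂ S

-- Over a given individual a, a temporal DL-Lite ontology without ⊥ behaves like its
-- surrogate LTL ontology T†: the assertions about a become LTL facts A(ℓ), E_P(ℓ),
-- E_P⁻(ℓ), padded with a fresh name at every time point of the ABox. A DL model
-- yields an LTL model by reading off a; conversely, an LTL model extends to a DL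
-- model in which every other element satisfies every concept, and this model
-- satisfies all CIs because none has an empty right-hand side. So a is a certain answer at ℓ iff
-- ℓ is a certain LTL answer over the projected ABox, and an LTL rewriting becomes a
-- DL rewriting once each LTL atom is replaced by its first-order definition over the
-- DL ABox: A(x, t), ∃y P(x, y, t), ∃y P(y, x, t), or "t is a time point".

module Submission where

open import Defs
open import Data.Nat using (ℕ; zero; suc; _≤_; _<_; _⊔_; _≡ᵇ_; z≤n; s≤s)
open import Data.Nat.Properties
  using (_≟_; ≤-refl; ≤-trans; ≤-antisym; ⊔-lub; m≤m⊔n; m≤n⊔m; m⊔n<o⇒m<o; m⊔n<o⇒n<o; <⇒≢)
open import Data.Integer using (ℤ; +_)
open import Data.Bool using (true; false)
open import Data.List using (List; []; _∷_; _++_; map; foldr; concatMap; applyUpTo)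
open import Data.List.Properties using (map-∘; map-cong)
open import Data.List.Membership.Propositional using (_∈_; find)
open import Data.List.Membership.Propositional.Properties
  using (∈-++⁺ˡ; ∈-++⁺ʳ; ∈-++⁻; ∈-concatMap⁺; ∈-concatMap⁻; ∈-applyUpTo⁺; ∈-applyUpTo⁻)
open import Data.List.Relation.Unary.All as All using (All; []; _∷_)
import Data.List.Relation.Unary.All.Properties as All
open import Data.List.Relation.Unary.Any as Any using (Any; here; there)
open import Data.Maybe using (just; nothing)
open import Data.Product using (_×_; _,_; proj₁; proj₂; ∃-syntax)
open import Data.Product.Function.NonDependent.Propositional using (_×-⇔_)
open import Data.Sum using (_⊎_; inj₁; inj₂)
open import Data.Sum.Function.Propositional using (_⊎-⇔_)
open import Data.Sum.Properties using (inj₁-injective)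
open import Data.Empty using (⊥; ⊥-elim)
open import Data.Unit using (⊤; tt)
open import Relation.Nullary using (¬_; Dec; yes; no)
open import Relation.Binary.PropositionalEquality using (_≡_; _≢_; refl; sym; trans; subst)
open import Function.Bundles using (_⇔_; mk⇔; Equivalence)
open import Function.Related.TypeIsomorphisms using (¬-cong-⇔)
import Function.Properties.Equivalence as ⇔

open Equivalence using (to; from)

∀-⇔ : {K : Set} {R A B : K → Set} → (∀ k → A k ⇔ B k) → (∀ k → R k → A k) ⇔ (∀ k → R k → B k)
∀-⇔ A⇔B = mk⇔ (λ h k r → to (A⇔B k) (h k r)) (λ h k r → from (A⇔B k) (h k r))

∀≤-⇔ : {N N′ : ℕ} {A B : ℕ → Set} → N ≡ N′ → (∀ n → A n ⇔ B n) →
       (∀ n → n ≤ N → A n) ⇔ (∀ n → n ≤ N′ → B n)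
∀≤-⇔ refl = ∀-⇔

∃≤-⇔ : {N N′ : ℕ} {A B : ℕ → Set} → N ≡ N′ → (∀ n → A n ⇔ B n) →
       (∃[ n ] n ≤ N × A n) ⇔ (∃[ n ] n ≤ N′ × B n)
∃≤-⇔ refl A⇔B = mk⇔ (λ (n , n≤ , h) → n , n≤ , to (A⇔B n) h) (λ (n , n≤ , h) → n , n≤ , from (A⇔B n) h)

maxOf : {X : Set} → (X → ℕ) → List X → ℕ
maxOf f = foldr (λ x m → f x ⊔ m) 0

maxOf-< : {X : Set} (f : X → ℕ) (xs : List X) {d : ℕ} → maxOf f xs < d → All (λ x → f x < d) xs
maxOf-< f []       _ = []
maxOf-< f (x ∷ xs) h = m⊔n<o⇒m<o (f x) _ h ∷ maxOf-< f xs (m⊔n<o⇒n<o (f x) _ h)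

-- Variables 0 (the individual x) and 2 (a role successor) are kept free for the DL atoms.
shift : Var → Var
shift v = suc (suc (suc v))

module Translation {P Q : Set} (atom : P → List Var → Fm Q) where

  mutual
    translate : Fm P → Fm Q
    translate (dat p vs) = atom p vs
    translate (x ≐ y)    = shift x ≐ shift y
    translate (x ≺ y)    = shift x ≺ shift y
    translate (modZ n x) = modZ n (shift x)
    translate (rel q vs) = rel q (map shift vs)
    translate (rpr ds ψ) = rpr (translateDefs ds) (translate ψ)
    translate (¬' φ)     = ¬' (translate φ)
    translate (φ ∧' ψ)   = translate φ ∧' translate ψ
    translate (φ ∨' ψ)   = translate φ ∨' translate ψ
    translate (∀' v φ)   = ∀' (shift v) (translate φ)
    translate (∃' v φ)   = ∃' (shift v) (translate φ)

    translateDefs : List (RDef P) → List (RDef Q)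
    translateDefs [] = []
    translateDefs (def q zs t θ ∷ ds) =
      def q (map shift zs) (shift t) (translate θ) ∷ translateDefs ds

  -- The LTL answer variable 1 is shifted to 4 and rebound to the DL answer variable 1.
  answer : Fm P → Fm Q
  answer φ = ∃' 4 ((4 ≐ 1) ∧' translate φ)

  names-translateDefs : ∀ ds → names (translateDefs ds) ≡ names ds
  names-translateDefs [] = refl
  names-translateDefs (def q _ _ _ ∷ ds) rewrite names-translateDefs ds = refl

  module _ (atom-allowed : ∀ L p vs → Allowed L (atom p vs)) where

    mutual
      translate-allowed : ∀ L φ → Allowed L φ → Allowed L (translate φ)
      translate-allowed L     (dat p vs) _ = atom-allowed L p vs
      translate-allowed L     (x ≐ y)    h = h
      translate-allowed L     (x ≺ y)    h = h
      translate-allowed FO<≡  (modZ n x) h = h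
      translate-allowed FORPR (rel q vs) h = h
      translate-allowed FORPR (rpr ds ψ) (hds , hψ) =
        translateDefs-allowed ds hds , translate-allowed FORPR ψ hψ
      translate-allowed L     (¬' φ)     h = translate-allowed L φ h
      translate-allowed L     (φ ∧' ψ)   (hφ , hψ) = translate-allowed L φ hφ , translate-allowed L ψ hψ
      translate-allowed L     (φ ∨' ψ)   (hφ , hψ) = translate-allowed L φ hφ , translate-allowed L ψ hψ
      translate-allowed L     (∀' v φ)   h = translate-allowed L φ h
      translate-allowed L     (∃' v φ)   h = translate-allowed L φ h
      translate-allowed FO<   (modZ _ _) ()
      translate-allowed FORPR (modZ _ _) ()
      translate-allowed FO<   (rel _ _)  ()
      translate-allowed FO<≡  (rel _ _)  ()
      translate-allowed FO<   (rpr _ _)  ()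
      translate-allowed FO<≡  (rpr _ _)  ()

      translateDefs-allowed : ∀ ds → AllowedDefs ds → AllowedDefs (translateDefs ds)
      translateDefs-allowed [] _ = tt
      translateDefs-allowed (def q zs t θ ∷ ds) (hθ , hds) =
        translate-allowed FORPR θ hθ , translateDefs-allowed ds hds

record Represents (a : ℕ) (σ σ′ : Env) : Set where
  field
    shifted    : ∀ v → σ′ (shift v) ≡ σ v
    individual : σ′ 0 ≡ a
open Represents

represents-update : ∀ {a σ σ′} v n → Represents a σ σ′ →
                    Represents a (σ [ v ↦ n ]) (σ′ [ shift v ↦ n ])
represents-update v n r .individual = individual r
represents-update v n r .shifted w with w ≡ᵇ v
... | true  = refl
... | false = shifted r w

represents-update* : ∀ {a σ σ′} vs ns → Represents a σ σ′ →
                     Represents a (σ [ vs ↦* ns ]) (σ′ [ map shift vs ↦* ns ])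
represents-update* []       _        r = r
represents-update* (_ ∷ _)  []       r = r
represents-update* (v ∷ vs) (n ∷ ns) r = represents-update* vs ns (represents-update v n r)

map-represents : ∀ {a σ σ′} → Represents a σ σ′ → ∀ vs → map σ′ (map shift vs) ≡ map σ vs
map-represents r vs = trans (sym (map-∘ vs)) (map-cong (shifted r) vs)

_≋_ : RelEnv → RelEnv → Set
ρ ≋ ρ′ = ∀ q zs → ρ q zs ⇔ ρ′ q zs

module Simulation {P Q : Set} (𝔐 : Structure P) (𝔑 : Structure Q)
                  (same-domain : Structure.N 𝔐 ≡ Structure.N 𝔑)
                  (a : ℕ) (atom : P → List Var → Fm Q)
                  (atom-correct : ∀ {σ σ′} ρ′ p vs → Represents a σ σ′ →
                                  Structure.D 𝔐 p (map σ vs) ⇔ Semantics.sat 𝔑 σ′ ρ′ (atom p vs))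
                  where

  open Translation atom
  module 𝔐 = Semantics 𝔐
  module 𝔑 = Semantics 𝔑

  override-≋ : ∀ ds {new new′ ρ ρ′} → new ≋ new′ → ρ ≋ ρ′ →
               override ds new ρ ≋ override (translateDefs ds) new′ ρ′
  override-≋ ds new≋ ρ≋ q zs rewrite names-translateDefs ds with memb q (names ds)
  ... | true  = new≋ q zs
  ... | false = ρ≋ q zs

  mutual
    sat-translate : ∀ φ {σ σ′ ρ ρ′} → Represents a σ σ′ → ρ ≋ ρ′ →
                    𝔐.sat σ ρ φ ⇔ 𝔑.sat σ′ ρ′ (translate φ)
    sat-translate (dat p vs) {ρ′ = ρ′} r _ = atom-correct ρ′ p vs r
    sat-translate (x ≐ y)    r _ rewrite shifted r x | shifted r y = ⇔.refl
    sat-translate (x ≺ y)    r _ rewrite shifted r x | shifted r y = ⇔.refl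
    sat-translate (modZ n x) r _ rewrite shifted r x = ⇔.refl
    sat-translate (rel q vs) {σ} r ρ≋ rewrite map-represents r vs = ρ≋ q (map σ vs)
    sat-translate (rpr ds ψ) r ρ≋ = sat-translate ψ r (override-≋ ds (full-translate ds r ρ≋) ρ≋)
    sat-translate (¬' φ)   r ρ≋ = ¬-cong-⇔ (sat-translate φ r ρ≋)
    sat-translate (φ ∧' ψ) r ρ≋ = sat-translate φ r ρ≋ ×-⇔ sat-translate ψ r ρ≋
    sat-translate (φ ∨' ψ) r ρ≋ = sat-translate φ r ρ≋ ⊎-⇔ sat-translate ψ r ρ≋
    sat-translate (∀' v φ) r ρ≋ =
      ∀≤-⇔ same-domain (λ n → sat-translate φ (represents-update v n r) ρ≋)
    sat-translate (∃' v φ) r ρ≋ =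
      ∃≤-⇔ same-domain (λ n → sat-translate φ (represents-update v n r) ρ≋)

    full-translate : ∀ ds {σ σ′ ρ ρ′} → Represents a σ σ′ → ρ ≋ ρ′ →
                     𝔐.full σ ρ ds ≋ 𝔑.full σ′ ρ′ (translateDefs ds)
    full-translate ds r ρ≋ q args with splitLast args
    ... | just (zs , t) = cur-translate ds r ρ≋ t q zs
    ... | nothing       = ⇔.refl

    cur-translate : ∀ ds {σ σ′ ρ ρ′} → Represents a σ σ′ → ρ ≋ ρ′ → ∀ t →
                    𝔐.cur σ ρ ds t ≋ 𝔑.cur σ′ ρ′ (translateDefs ds) t
    cur-translate ds r ρ≋ t = step-translate ds r ρ≋ t (prev-translate ds r ρ≋ t) ds

    prev-translate : ∀ ds {σ σ′ ρ ρ′} → Represents a σ σ′ → ρ ≋ ρ′ → ∀ t →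
                     𝔐.prev σ ρ ds t ≋ 𝔑.prev σ′ ρ′ (translateDefs ds) t
    prev-translate ds r ρ≋ zero    _ _ = ⇔.refl
    prev-translate ds r ρ≋ (suc t)     = cur-translate ds r ρ≋ t

    step-translate : ∀ ds {σ σ′ ρ ρ′} → Represents a σ σ′ → ρ ≋ ρ′ → ∀ t {pv pv′} → pv ≋ pv′ → ∀ es →
                     𝔐.step σ ρ ds t pv es ≋
                     𝔑.step σ′ ρ′ (translateDefs ds) t pv′ (translateDefs es)
    step-translate ds r ρ≋ t pv≋ [] _ _ = ⇔.refl
    step-translate ds r ρ≋ t pv≋ (def q′ vs tv θ ∷ es) q zs with q ≡ᵇ q′
    ... | true  = sat-translate θ (represents-update tv t (represents-update* vs zs r))
                                  (override-≋ ds pv≋ ρ≋)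
    ... | false = step-translate ds r ρ≋ t pv≋ es q zs

  sat-answer : ∀ φ {ℓ} → ℓ ≤ Structure.N 𝔑 →
               𝔐.sat (initEnv 0 ℓ) initRel φ ⇔ 𝔑.sat (initEnv a ℓ) initRel (answer φ)
  sat-answer φ {ℓ} ℓ≤ = mk⇔
    (λ h → ℓ , ℓ≤ , refl , to (sat-translate φ r initRel≋) h)
    (λ { (_ , _ , refl , h) → from (sat-translate φ r initRel≋) h })
    where
      r : Represents a (initEnv 0 ℓ) (initEnv a ℓ [ 4 ↦ ℓ ])
      r .individual = refl
      r .shifted zero = refl
      r .shifted (suc zero) = refl
      r .shifted (suc (suc _)) = refl

      initRel≋ : initRel ≋ initRel
      initRel≋ _ _ = ⇔.refl

tmax-upper : ∀ {𝒜 : ABox ℕ ℕ} {α} → α ∈ 𝒜 → timeOf α ≤ tmax 𝒜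
tmax-upper (here refl) = m≤m⊔n _ _
tmax-upper {β ∷ _} (there α∈) = ≤-trans (tmax-upper α∈) (m≤n⊔m (timeOf β) _)

ltmax-upper : ∀ {CN} {𝒜 : LTLABox CN} {x} → x ∈ 𝒜 → proj₂ x ≤ ltmax 𝒜
ltmax-upper (here refl) = m≤m⊔n _ _
ltmax-upper {𝒜 = (_ , ℓ) ∷ _} (there x∈) = ≤-trans (ltmax-upper x∈) (m≤n⊔m ℓ _)

ltmax-least : ∀ {CN} (𝒜 : LTLABox CN) {N} → (∀ {x} → x ∈ 𝒜 → proj₂ x ≤ N) → ltmax 𝒜 ≤ N
ltmax-least []      _ = z≤n
ltmax-least (_ ∷ 𝒜) h = ⊔-lub (h (here refl)) (ltmax-least 𝒜 (λ x∈ → h (there x∈)))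

subject-∈ind : ∀ {𝒜 : ABox ℕ ℕ} {P k k′ ℓ} → rAss P k k′ ℓ ∈ 𝒜 → k ∈ind 𝒜
subject-∈ind α∈ = ∈-concatMap⁺ indsOf (Any.map (λ { refl → here refl }) α∈)

object-∈ind : ∀ {𝒜 : ABox ℕ ℕ} {P k k′ ℓ} → rAss P k k′ ℓ ∈ 𝒜 → k′ ∈ind 𝒜
object-∈ind α∈ = ∈-concatMap⁺ indsOf (Any.map (λ { refl → there (here refl) }) α∈)

normalised-ind≤ : ∀ {𝒜 : ABox ℕ ℕ} → Normalised 𝒜 → ∀ {k} → k ∈ind 𝒜 → k ≤ tmax 𝒜
normalised-ind≤ (m , ind⇔ , _ , 1⊔m≤) k∈ = ≤-trans (to (ind⇔ _) k∈) (≤-trans (m≤n⊔m 1 m) 1⊔m≤)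

LName : Set
LName = ℕ ⊎ Role ℕ

onlyIf : {P X : Set} → Dec P → X → List X
onlyIf (yes _) x = x ∷ []
onlyIf (no _)  _ = []

∈-onlyIf⁺ : {P X : Set} (p? : Dec P) {x : X} → P → x ∈ onlyIf p? x
∈-onlyIf⁺ (yes _) _ = here refl
∈-onlyIf⁺ (no ¬p) p = ⊥-elim (¬p p)

∈-onlyIf⁻ : {P X : Set} (p? : Dec P) {x y : X} → y ∈ onlyIf p? x → P × y ≡ x
∈-onlyIf⁻ (yes p) (here refl) = p , refl

factsAbout : ℕ → Assertion ℕ ℕ → LTLABox LName
factsAbout a (cAss A k ℓ)    = onlyIf (k ≟ a) (inj₁ A , ℓ)
factsAbout a (rAss P k k′ ℓ) = onlyIf (k ≟ a) (inj₂ (pos P) , ℓ) ++ onlyIf (k′ ≟ a) (inj₂ (inv P) , ℓ)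

about : ℕ → ABox ℕ ℕ → LTLABox LName
about a 𝒜 = concatMap (factsAbout a) 𝒜

Witnessed : ABox ℕ ℕ → ℕ → LName × ℕ → Set
Witnessed 𝒜 a (inj₁ A , ℓ)       = cAss A a ℓ ∈ 𝒜
Witnessed 𝒜 a (inj₂ (pos P) , ℓ) = ∃[ b ] rAss P a b ℓ ∈ 𝒜
Witnessed 𝒜 a (inj₂ (inv P) , ℓ) = ∃[ b ] rAss P b a ℓ ∈ 𝒜

witnessed-time : ∀ {𝒜 a} x → Witnessed 𝒜 a x → proj₂ x ≤ tmax 𝒜
witnessed-time (inj₁ _ , _)       α∈       = tmax-upper α∈
witnessed-time (inj₂ (pos _) , _) (_ , α∈) = tmax-upper α∈
witnessed-time (inj₂ (inv _) , _) (_ , α∈) = tmax-upper α∈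

module _ {𝒜 : ABox ℕ ℕ} {a : ℕ} where

  factsAbout-witnessed : ∀ {α x} → α ∈ 𝒜 → x ∈ factsAbout a α → Witnessed 𝒜 a x
  factsAbout-witnessed {cAss A k ℓ} α∈ x∈ with ∈-onlyIf⁻ (k ≟ a) x∈
  ... | refl , refl = α∈
  factsAbout-witnessed {rAss P k k′ ℓ} α∈ x∈ with ∈-++⁻ (onlyIf (k ≟ a) _) x∈
  ... | inj₁ x∈ˡ with ∈-onlyIf⁻ (k ≟ a) x∈ˡ
  ...   | refl , refl = k′ , α∈
  factsAbout-witnessed {rAss P k k′ ℓ} α∈ x∈ | inj₂ x∈ʳ with ∈-onlyIf⁻ (k′ ≟ a) x∈ʳ
  ...   | refl , refl = k , α∈

  ∈-about⁻ : ∀ {x} → x ∈ about a 𝒜 → Witnessed 𝒜 a x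
  ∈-about⁻ x∈ with _ , α∈ , x∈α ← find (∈-concatMap⁻ (factsAbout a) x∈) = factsAbout-witnessed α∈ x∈α

  ∈-about⁺ : ∀ {x} → Witnessed 𝒜 a x → x ∈ about a 𝒜
  ∈-about⁺ {inj₁ A , ℓ} α∈ =
    ∈-concatMap⁺ (factsAbout a) (Any.map (λ { refl → ∈-onlyIf⁺ (a ≟ a) refl }) α∈)
  ∈-about⁺ {inj₂ (pos P) , ℓ} (b , α∈) =
    ∈-concatMap⁺ (factsAbout a) (Any.map (λ { refl → ∈-++⁺ˡ (∈-onlyIf⁺ (a ≟ a) refl) }) α∈)
  ∈-about⁺ {inj₂ (inv P) , ℓ} (b , α∈) =
    ∈-concatMap⁺ (factsAbout a)
      (Any.map (λ { refl → ∈-++⁺ʳ (onlyIf (b ≟ a) _) (∈-onlyIf⁺ (a ≟ a) refl) }) α∈)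

-- The fresh name d holds at every time point 0, …, max 𝒜, so that the LTL ABox
-- is normalised and has the same temporal domain as 𝒜.
padding : ℕ → ℕ → LTLABox LName
padding d N = applyUpTo (inj₁ d ,_) (suc N)

ltlABox : ℕ → ℕ → ABox ℕ ℕ → LTLABox LName
ltlABox d a 𝒜 = padding d (tmax 𝒜) ++ about a 𝒜

module LtlABox (d a : ℕ) (𝒜 : ABox ℕ ℕ) where

  padding-∈ : ∀ {ℓ} → ℓ ≤ tmax 𝒜 → (inj₁ d , ℓ) ∈ ltlABox d a 𝒜
  padding-∈ ℓ≤ = ∈-++⁺ˡ (∈-applyUpTo⁺ (inj₁ d ,_) (s≤s ℓ≤))

  witnessed-∈ : ∀ {x} → Witnessed 𝒜 a x → x ∈ ltlABox d a 𝒜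
  witnessed-∈ w = ∈-++⁺ʳ (padding d (tmax 𝒜)) (∈-about⁺ w)

  ∈-ltlABox⁻ : ∀ {x} → x ∈ ltlABox d a 𝒜 → (proj₁ x ≡ inj₁ d × proj₂ x ≤ tmax 𝒜) ⊎ Witnessed 𝒜 a x
  ∈-ltlABox⁻ x∈ with ∈-++⁻ (padding d (tmax 𝒜)) x∈
  ... | inj₁ x∈ᵖ with _ , s≤s ℓ≤ , refl ← ∈-applyUpTo⁻ (inj₁ d ,_) {n = suc (tmax 𝒜)} x∈ᵖ =
    inj₁ (refl , ℓ≤)
  ... | inj₂ x∈ᵃ = inj₂ (∈-about⁻ x∈ᵃ)

  ∈-ltlABox-witnessed : ∀ {x} → proj₁ x ≢ inj₁ d → x ∈ ltlABox d a 𝒜 → Witnessed 𝒜 a x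
  ∈-ltlABox-witnessed x≢d x∈ with ∈-ltlABox⁻ x∈
  ... | inj₁ (x≡d , _) = ⊥-elim (x≢d x≡d)
  ... | inj₂ w = w

  ltlABox-time : ∀ {x} → x ∈ ltlABox d a 𝒜 → proj₂ x ≤ tmax 𝒜
  ltlABox-time {x} x∈ with ∈-ltlABox⁻ x∈
  ... | inj₁ (_ , ℓ≤) = ℓ≤
  ... | inj₂ w = witnessed-time x w

  ltmax-ltlABox : ltmax (ltlABox d a 𝒜) ≡ tmax 𝒜
  ltmax-ltlABox = ≤-antisym (ltmax-least (ltlABox d a 𝒜) ltlABox-time) (ltmax-upper (padding-∈ ≤-refl))

  ltlABox-normalised : LNormalised (ltlABox d a 𝒜)
  ltlABox-normalised = Any.map (λ { refl → refl }) (padding-∈ z≤n)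

maxName : TConcept ℕ ℕ → ℕ
maxName (basic (atom A)) = A
maxName (basic (ex _))   = 0
maxName (□F C) = maxName C
maxName (□P C) = maxName C
maxName (○F C) = maxName C
maxName (○P C) = maxName C

maxNameᶜⁱ : CI ℕ ℕ → ℕ
maxNameᶜⁱ (ls ⊑ rs) = maxOf maxName ls ⊔ maxOf maxName rs

Holds : (LName → ℤ → Set) → LName × ℕ → Set
Holds v x = v (proj₁ x) (+ proj₂ x)

basicExt-† : ∀ {v : LName → ℤ → Set} B {n} → basicExt (oneElt v) († B) n tt ⇔ v (†name B) n
basicExt-† (atom _) = ⇔.refl
basicExt-† (ex _)   = ⇔.refl

Agree : (I : Interp ℕ ℕ) → Interp.Δ I → (J : Interp LName ⊥) → Interp.Δ J → TConcept ℕ ℕ → Set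
Agree I e J e′ C = ∀ n → conceptExt I C n e ⇔ conceptExt J (†C C) n e′

module _ {I : Interp ℕ ℕ} {e : Interp.Δ I} {J : Interp LName ⊥} {e′ : Interp.Δ J} where

  all-† : ∀ {cs} → All (Agree I e J e′) cs → ∀ n →
          All (λ C → conceptExt I C n e) cs ⇔ All (λ C → conceptExt J C n e′) (map †C cs)
  all-† agree n = mk⇔
    (λ hs → All.map⁺ (All.zipWith (λ (ag , h) → to (ag n) h) (agree , hs)))
    (λ hs → All.zipWith (λ (ag , h) → from (ag n) h) (agree , All.map⁻ hs))

  any-† : ∀ {cs} → All (Agree I e J e′) cs → ∀ n →
          Any (λ C → conceptExt I C n e) cs ⇔ Any (λ C → conceptExt J C n e′) (map †C cs)
  any-† [] n = mk⇔ (λ ()) (λ ())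
  any-† (ag ∷ agree) n = mk⇔
    (λ { (here h) → here (to (ag n) h) ; (there h) → there (to (any-† agree n) h) })
    (λ { (here h) → here (from (ag n) h) ; (there h) → there (from (any-† agree n) h) })

unname : LName → Basic ℕ ℕ
unname (inj₁ A) = atom A
unname (inj₂ S) = ex S

trace : ℕ → (I : Interp ℕ ℕ) → Interp.Δ I → LName → ℤ → Set
trace d I e X n = X ≡ inj₁ d ⊎ basicExt I (unname X) n e

module _ {d : ℕ} {I : Interp ℕ ℕ} {e : Interp.Δ I} where

  trace-agree : ∀ C → maxName C < d → Agree I e (oneElt (trace d I e)) tt C
  trace-agree (basic (atom A)) A<d n =
    mk⇔ inj₂ (λ { (inj₁ refl) → ⊥-elim (<⇒≢ A<d refl) ; (inj₂ h) → h })
  trace-agree (basic (ex S)) _ n = mk⇔ inj₂ (λ { (inj₁ ()) ; (inj₂ h) → h })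
  trace-agree (□F C) C<d n = ∀-⇔ (trace-agree C C<d)
  trace-agree (□P C) C<d n = ∀-⇔ (trace-agree C C<d)
  trace-agree (○F C) C<d n = trace-agree C C<d _
  trace-agree (○P C) C<d n = trace-agree C C<d _

  trace-model : ∀ T → All (λ α → maxNameᶜⁱ α < d) T → ModelT I T → ModelT (oneElt (trace d I e)) (†T T)
  trace-model [] [] [] = []
  trace-model ((ls ⊑ rs) ∷ T) (α<d ∷ T<d) (sat ∷ sats) = sat† ∷ trace-model T T<d sats
    where
      agree : ∀ cs → maxOf maxName cs < d → All (Agree I e (oneElt (trace d I e)) tt) cs
      agree cs cs<d = All.map (λ {C} → trace-agree C) (maxOf-< maxName cs cs<d)

      sat† : SatCI (oneElt (trace d I e)) (map †C ls ⊑ map †C rs)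
      sat† n _ hs = to (any-† (agree rs (m⊔n<o⇒n<o _ _ α<d)) n)
                       (sat n e (from (all-† (agree ls (m⊔n<o⇒m<o _ _ α<d)) n) hs))

trace-ltlABox : ∀ {d I a 𝒜} → ModelA 𝒜 I → All (Holds (trace d I (Interp.ind I a))) (ltlABox d a 𝒜)
trace-ltlABox {d} {I} {a} {𝒜} ⊨𝒜 = All.tabulate λ x∈ → holds (∈-ltlABox⁻ x∈)
  where
    open LtlABox d a 𝒜

    holds : ∀ {x} → (proj₁ x ≡ inj₁ d × proj₂ x ≤ tmax 𝒜) ⊎ Witnessed 𝒜 a x →
            Holds (trace d I (Interp.ind I a)) x
    holds (inj₁ (refl , _)) = inj₁ refl
    holds {inj₁ A , ℓ}       (inj₂ α∈)       = inj₂ (All.lookup ⊨𝒜 α∈)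
    holds {inj₂ (pos P) , ℓ} (inj₂ (b , α∈)) = inj₂ (Interp.ind I b , All.lookup ⊨𝒜 α∈)
    holds {inj₂ (inv P) , ℓ} (inj₂ (b , α∈)) = inj₂ (Interp.ind I b , All.lookup ⊨𝒜 α∈)

ltlCertain⇒certain : ∀ {T B 𝒜 a ℓ d} → All (λ α → maxNameᶜⁱ α < d) T → maxName (basic B) < d →
                     LCertain (†T T) (†name B) (ltlABox d a 𝒜) ℓ → Certain T B 𝒜 a ℓ
ltlCertain⇒certain {T} {B} {ℓ = ℓ} T<d B<d ltlCertain I ⊨T ⊨𝒜 =
  from (trace-agree (basic B) B<d (+ ℓ))
    (from (basicExt-† B) (ltlCertain _ (trace-model T T<d ⊨T) (trace-ltlABox ⊨𝒜)))

module Lifting (a : ℕ) (𝒜 : ABox ℕ ℕ) (v : LName → ℤ → Set) where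

  IsA : ℕ ⊎ ⊤ → Set
  IsA (inj₁ k) = k ≡ a
  IsA (inj₂ _) = ⊥

  -- Only the individual a is constrained, by v; every other element belongs to
  -- every concept, and inj₂ tt serves as a role successor for all of them.
  lifted : Interp ℕ ℕ
  lifted = record { Δ = ℕ ⊎ ⊤ ; ind = inj₁ ; conc = conc ; role = role }
    where
      conc : ℕ → ℤ → ℕ ⊎ ⊤ → Set
      conc A n e = IsA e → v (inj₁ A) n

      role : ℕ → ℤ → ℕ ⊎ ⊤ → ℕ ⊎ ⊤ → Set
      role P n (inj₁ k) (inj₁ k′) = ∃[ ℓ ] n ≡ + ℓ × rAss P k k′ ℓ ∈ 𝒜
      role P n (inj₁ k) (inj₂ _)  = k ≡ a → v (inj₂ (pos P)) n
      role P n (inj₂ _) e         = IsA e → v (inj₂ (inv P)) n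

  lifted-other : ∀ e → ¬ IsA e → ∀ C n → conceptExt lifted C n e
  lifted-other e        ¬a (basic (atom A))      n = λ a → ⊥-elim (¬a a)
  lifted-other (inj₁ k) ¬a (basic (ex (pos P))) n = inj₂ tt , λ a → ⊥-elim (¬a a)
  lifted-other (inj₂ _) ¬a (basic (ex (pos P))) n = inj₂ tt , λ ()
  lifted-other e        ¬a (basic (ex (inv P))) n = inj₂ tt , λ a → ⊥-elim (¬a a)
  lifted-other e        ¬a (□F C) n = λ k _ → lifted-other e ¬a C k
  lifted-other e        ¬a (□P C) n = λ k _ → lifted-other e ¬a C k
  lifted-other e        ¬a (○F C) n = lifted-other e ¬a C _
  lifted-other e        ¬a (○P C) n = lifted-other e ¬a C _

  module _ (holds : ∀ {x} → Witnessed 𝒜 a x → Holds v x) where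

    lifted-agree : ∀ C → Agree lifted (inj₁ a) (oneElt v) tt C
    lifted-agree (basic (atom A)) n = mk⇔ (λ h → h refl) (λ h _ → h)
    lifted-agree (basic (ex (pos P))) n = mk⇔
      (λ { (inj₁ b , ℓ , refl , α∈) → holds (b , α∈) ; (inj₂ _ , h) → h refl })
      (λ h → inj₂ tt , λ _ → h)
    lifted-agree (basic (ex (inv P))) n = mk⇔
      (λ { (inj₁ b , ℓ , refl , α∈) → holds (b , α∈) ; (inj₂ _ , h) → h refl })
      (λ h → inj₂ tt , λ _ → h)
    lifted-agree (□F C) n = ∀-⇔ (lifted-agree C)
    lifted-agree (□P C) n = ∀-⇔ (lifted-agree C)
    lifted-agree (○F C) n = lifted-agree C _
    lifted-agree (○P C) n = lifted-agree C _

    lifted-model : ∀ T → NoBot T → ModelT (oneElt v) (†T T) → ModelT lifted T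
    lifted-model [] [] [] = []
    lifted-model ((ls ⊑ (r ∷ rs)) ∷ T) (nonEmpty _ _ ∷ noBot) (sat† ∷ sats) =
      sat ∷ lifted-model T noBot sats
      where
        sat : SatCI lifted (ls ⊑ (r ∷ rs))
        sat n (inj₂ _) _ = here (lifted-other (inj₂ tt) (λ ()) r n)
        sat n (inj₁ k) hs with k ≟ a
        ... | no k≢a = here (lifted-other (inj₁ k) k≢a r n)
        ... | yes refl = from (any-† (All.universal lifted-agree (r ∷ rs)) n)
                              (sat† n tt (to (all-† (All.universal lifted-agree ls) n) hs))

    lifted-ABox : ModelA 𝒜 lifted
    lifted-ABox = All.tabulate λ
      { {cAss A k ℓ}    α∈ refl → holds α∈
      ; {rAss P k k′ ℓ} α∈      → ℓ , refl , α∈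
      }

certain⇒ltlCertain : ∀ {T B 𝒜 a ℓ d} → NoBot T →
                     Certain T B 𝒜 a ℓ → LCertain (†T T) (†name B) (ltlABox d a 𝒜) ℓ
certain⇒ltlCertain {T} {B} {𝒜} {a} {ℓ} {d} noBot certain v ⊨T ⊨𝒜ₐ =
  to (basicExt-† B) (to (lifted-agree holds (basic B) (+ ℓ))
    (certain lifted (lifted-model holds T noBot ⊨T) (lifted-ABox holds)))
  where
    open Lifting a 𝒜 v
    open LtlABox d a 𝒜

    holds : ∀ {x} → Witnessed 𝒜 a x → Holds v x
    holds w = All.lookup ⊨𝒜ₐ (witnessed-∈ w)

module SurrogateAtoms (d : ℕ) where

  -- A(t) becomes A(x, t) and E_P(t) becomes ∃y P(x, y, t); the padding name d
  -- holds exactly at the time points of the ABox.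
  unaryAtom : LName → Var → Fm (ℕ ⊎ ℕ)
  unaryAtom (inj₁ A) t with A ≟ d
  ... | yes _ = ∃' 2 (t ≐ 2)
  ... | no _  = dat (inj₁ A) (0 ∷ t ∷ [])
  unaryAtom (inj₂ (pos P)) t = ∃' 2 (dat (inj₂ P) (0 ∷ 2 ∷ t ∷ []))
  unaryAtom (inj₂ (inv P)) t = ∃' 2 (dat (inj₂ P) (2 ∷ 0 ∷ t ∷ []))

  ltlAtom : LName → List Var → Fm (ℕ ⊎ ℕ)
  ltlAtom X (t ∷ []) = unaryAtom X (shift t)
  ltlAtom _ _        = ¬' (0 ≐ 0)

  ltlAtom-allowed : ∀ L X vs → Allowed L (ltlAtom X vs)
  ltlAtom-allowed L X [] = tt
  ltlAtom-allowed L X (_ ∷ _ ∷ _) = tt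
  ltlAtom-allowed L (inj₁ A) (t ∷ []) with A ≟ d
  ... | yes _ = tt
  ... | no _  = tt
  ltlAtom-allowed L (inj₂ (pos P)) (t ∷ []) = tt
  ltlAtom-allowed L (inj₂ (inv P)) (t ∷ []) = tt

  module _ {a : ℕ} {𝒜 : ABox ℕ ℕ} (ind≤ : ∀ {k} → k ∈ind 𝒜 → k ≤ tmax 𝒜) where

    open LtlABox d a 𝒜

    false⇔ : ∀ {σ′ : Env} {X : Set} → ¬ X → X ⇔ (¬ σ′ 0 ≡ σ′ 0)
    false⇔ ¬x = mk⇔ (λ x → ⊥-elim (¬x x)) (λ h → ⊥-elim (h refl))

    ltlAtom-correct : ∀ {σ σ′} ρ′ X vs → Represents a σ σ′ →
                      Structure.D (𝔖L (ltlABox d a 𝒜)) X (map σ vs) ⇔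
                      Semantics.sat (𝔖 𝒜) σ′ ρ′ (ltlAtom X vs)
    ltlAtom-correct {σ′ = σ′} _ _ []          _ = false⇔ {σ′} (λ ())
    ltlAtom-correct {σ′ = σ′} _ _ (_ ∷ _ ∷ _) _ = false⇔ {σ′} (λ ())
    ltlAtom-correct {σ} _ (inj₁ A) (t ∷ []) r with A ≟ d
    ... | yes refl rewrite shifted r t =
      mk⇔ (λ x∈ → σ t , ltlABox-time x∈ , refl) (λ { (_ , t≤ , refl) → padding-∈ t≤ })
    ... | no A≢d rewrite individual r | shifted r t =
      mk⇔ (∈-ltlABox-witnessed (λ eq → A≢d (inj₁-injective eq))) witnessed-∈
    ltlAtom-correct _ (inj₂ (pos P)) (t ∷ []) r rewrite individual r | shifted r t =
      mk⇔ (λ x∈ → let b , α∈ = ∈-ltlABox-witnessed {inj₂ (pos P) , _} (λ ()) x∈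
                  in b , ind≤ (object-∈ind α∈) , α∈)
          (λ (b , _ , α∈) → witnessed-∈ (b , α∈))
    ltlAtom-correct _ (inj₂ (inv P)) (t ∷ []) r rewrite individual r | shifted r t =
      mk⇔ (λ x∈ → let b , α∈ = ∈-ltlABox-witnessed {inj₂ (inv P) , _} (λ ()) x∈
                  in b , ind≤ (subject-∈ind α∈) , α∈)
          (λ (b , _ , α∈) → witnessed-∈ (b , α∈))

freshName : TBox ℕ ℕ → Basic ℕ ℕ → ℕ
freshName T B = suc (maxOf maxNameᶜⁱ T ⊔ maxName (basic B))

proposition7 : (L : Lang) (T : TBox ℕ ℕ) (B : Basic ℕ ℕ) →
               NoBot T →
               LRewritable L (†T T) (†name B) →
               Rewritable L T B
proposition7 L T B noBot (Q , Q-allowed , Q-rewrites) =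
  answer Q , (tt , translate-allowed ltlAtom-allowed L Q Q-allowed) , correct
  where
    d : ℕ
    d = freshName T B
    open SurrogateAtoms d
    open Translation ltlAtom

    T<d : All (λ α → maxNameᶜⁱ α < d) T
    T<d = maxOf-< maxNameᶜⁱ T (s≤s (m≤m⊔n _ _))

    B<d : maxName (basic B) < d
    B<d = s≤s (m≤n⊔m _ _)

    correct : ∀ 𝒜 → Normalised 𝒜 → ∀ a ℓ → a ∈ind 𝒜 → ℓ ≤ tmax 𝒜 →
              Certain T B 𝒜 a ℓ ⇔ Semantics.sat (𝔖 𝒜) (initEnv a ℓ) initRel (answer Q)
    correct 𝒜 normalised a ℓ _ ℓ≤ =
      ⇔.trans (mk⇔ (certain⇒ltlCertain noBot) (ltlCertain⇒certain T<d B<d))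
        (⇔.trans (Q-rewrites (ltlABox d a 𝒜) ltlABox-normalised ℓ
                             (subst (ℓ ≤_) (sym ltmax-ltlABox) ℓ≤))
                 (sat-answer Q ℓ≤))
      where
        open LtlABox d a 𝒜
        open Simulation (𝔖L (ltlABox d a 𝒜)) (𝔖 𝒜) ltmax-ltlABox a ltlAtom
                        (ltlAtom-correct (normalised-ind≤ normalised))
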